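{- Let $G$ be a graph with ${\rm ldim}(G)=2$. Then ${\rm fdim}(G)={\rm idim}(G)+i$, where $i=1$ if $G$ is isomorphic to the Cartesian product of two paths, and $i=0$ otherwise.
   Context: All graphs are finite. The $d$-cube $Q_d$ has vertex set $\{0,1\}^d$, two vertices adjacent iff they differ in exactly one coordinate. A Fibonacci string is a binary string with no two consecutive $1$s; the Fibonacci cube $\Gamma_d$ is the subgraph of $Q_d$ induced by the Fibonacci strings of length $d$. An isometric embedding is an injective map preserving shortest-path distances. $\mathbb{Z}^\ell$ is regarded as the infinite graph in which two points are adjacent iff their $L_1$-distance is $1$. ${\rm idim}(G)$, ${\rm fdim}(G)$, ${\rm ldim}(G)$ are the least integers $k$ such that $G$ isometrically embeds into $Q_k$, $\Gamma_k$, $\mathbb{Z}^k$ respectively. -}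

module Defs where

open import Data.Nat using (ℕ; zero; suc; _+_; _≤_; _<_)
open import Data.Integer as ℤ using (ℤ; ∣_∣; _-_)
open import Data.Bool using (Bool; true; false; _≟_)
open import Data.Fin using (Fin; toℕ)
open import Data.Vec using (Vec; []; _∷_)
open import Data.Product using (Σ; ∃; _×_; _,_; proj₁)
open import Data.Sum using (_⊎_)
open import Data.Unit using (⊤)
open import Data.Empty using (⊥)
open import Relation.Nullary using (¬_; yes; no)
open import Relation.Binary.PropositionalEquality using (_≡_)
open import Function.Bundles using (_⇔_)

record Graph : Set₁ where
  field
    V : Set
    E : V → V → Set
open Graph public

data Walk (G : Graph) : V G → V G → ℕ → Set where
  here : ∀ {u} → Walk G u u 0
  step : ∀ {u v w k} → E G u v → Walk G v w k → Walk G u w (suc k)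

Dist : (G : Graph) → V G → V G → ℕ → Set
Dist G u v k = Walk G u v k × (∀ m → Walk G u v m → k ≤ m)

IsIsometricEmbedding : (G H : Graph) → (V G → V H) → Set
IsIsometricEmbedding G H f =
  (∀ {x y} → f x ≡ f y → x ≡ y) ×
  (∀ u v k → Dist G u v k ⇔ Dist H (f u) (f v) k)

Embeds : Graph → Graph → Set
Embeds G H = Σ (V G → V H) (IsIsometricEmbedding G H)

record FinGraph (n : ℕ) : Set₁ where
  field
    Adj : Fin n → Fin n → Set
    Adj-sym : ∀ {u v} → Adj u v → Adj v u
    Adj-irrefl : ∀ {u} → ¬ Adj u u
open FinGraph public

toGraph : ∀ {n} → FinGraph n → Graph
toGraph {n} G = record { V = Fin n ; E = Adj G }

hamming : ∀ {d} → Vec Bool d → Vec Bool d → ℕ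
hamming [] [] = 0
hamming (x ∷ xs) (y ∷ ys) with x ≟ y
... | yes _ = hamming xs ys
... | no _ = suc (hamming xs ys)

Cube : ℕ → Graph
Cube d = record { V = Vec Bool d ; E = λ x y → hamming x y ≡ 1 }

Fib : ∀ {d} → Vec Bool d → Set
Fib [] = ⊤
Fib (false ∷ xs) = Fib xs
Fib (true ∷ []) = ⊤
Fib (true ∷ false ∷ xs) = Fib xs
Fib (true ∷ true ∷ xs) = ⊥

FibCube : ℕ → Graph
FibCube d = record
  { V = Σ (Vec Bool d) Fib
  ; E = λ x y → hamming (proj₁ x) (proj₁ y) ≡ 1 }

l1 : ∀ {ℓ} → Vec ℤ ℓ → Vec ℤ ℓ → ℕ
l1 [] [] = 0
l1 (x ∷ xs) (y ∷ ys) = ∣ x - y ∣ + l1 xs ys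

Lattice : ℕ → Graph
Lattice ℓ = record { V = Vec ℤ ℓ ; E = λ x y → l1 x y ≡ 1 }

IsLeastDim : (F : ℕ → Graph) → Graph → ℕ → Set
IsLeastDim F G k = Embeds G (F k) × (∀ m → m < k → ¬ Embeds G (F m))

IsIdim IsFdim IsLdim : Graph → ℕ → Set
IsIdim = IsLeastDim Cube
IsFdim = IsLeastDim FibCube
IsLdim = IsLeastDim Lattice

_adj1_ : ∀ {a} → Fin a → Fin a → Set
i adj1 j = suc (toℕ i) ≡ toℕ j ⊎ suc (toℕ j) ≡ toℕ i

GridGraph : ℕ → ℕ → Graph
GridGraph a b = record
  { V = Fin a × Fin b
  ; E = λ { (x , y) (x' , y') → (x ≡ x' × y adj1 y') ⊎ (y ≡ y' × x adj1 x') } }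

Isomorphic : Graph → Graph → Set
Isomorphic G H = Σ (V G → V H) λ f →
  (∀ {x y} → f x ≡ f y → x ≡ y) ×
  (∀ y → ∃ λ x → f x ≡ y) ×
  (∀ u v → E G u v ⇔ E H (f u) (f v))

IsProductOfTwoPaths : Graph → Set
IsProductOfTwoPaths G = Σ ℕ λ a → Σ ℕ λ b →
  1 ≤ a × 1 ≤ b × Isomorphic G (GridGraph a b)

module Submission where

-- An isometric embedding of G into ℤ², shifted, gives coordinates (α , β) of
-- G in a box [0,p] × [0,q] whose sides all contain vertices, such that the
-- path metric of G is the ℓ¹ distance.  Then idim(G) = p + q: each vertex is
-- coded by a Fibonacci path code of α followed by one of β, and conversely
-- each of the p + q levels of the box is crossed by an edge, these edges are
-- pairwise Θ-unrelated, and Θ-unrelated edges of Q_m flip distinct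
-- coordinates.  The same codes lie in Γ_{p+q} unless the junction reads 11,
-- which happens only at the corner (p , q): so fdim(G) ≤ p + q + 1, with
-- equality to p + q when some corner of the box is empty (move it to (p , q)
-- by reflections).  If all corners are occupied G is the grid P_{p+1} □ P_{q+1},
-- and an embedding into Γ_{p+q} would send both diagonals of the grid to
-- complementary strings, which is impossible as both sides are positive.

open import Defs
open import Data.Nat using (ℕ; zero; suc; _+_; _∸_; _≤_; _<_; z≤n; s≤s; ∣_-_∣; _≡ᵇ_; _≟_; _<?_)
open import Data.Nat.Properties
open import Algebra.Properties.CommutativeSemigroup +-commutativeSemigroup using (interchange)
open import Data.Integer as ℤ using (ℤ)
import Data.Integer.Properties as ℤP
import Data.Integer.Tactic.RingSolver as ℤSolver
open import Data.Bool using (Bool; true; false; not)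
import Data.Bool as Bool
import Data.Bool.Properties as BoolP
open import Data.Vec using (Vec; []; _∷_; _++_; [_]; reverse; _∷ʳ_; head; tail)
import Data.Vec as Vec
import Data.Vec.Properties as VecP
open import Data.Fin as Fin using (Fin; toℕ; fromℕ<)
import Data.Fin.Properties as FinP
open import Data.Product using (Σ; _×_; _,_; proj₁; proj₂)
open import Data.Sum using (_⊎_; inj₁; inj₂; [_,_]′) renaming (map to ⊎-map)
open import Data.Empty using (⊥-elim)
open import Data.Unit using (⊤; tt)
open import Relation.Nullary using (¬_; Dec; yes; no)
open import Relation.Binary.PropositionalEquality hiding ([_])
open import Function.Bundles using (_⇔_; mk⇔; Equivalence)
open import Function.Base using (_∘_; id)
open import Relation.Nullary.Decidable using (_×-dec_)

walk-++ : ∀ {G : Graph} {u v w i j} → Walk G u v i → Walk G v w j → Walk G u w (i + j)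
walk-++ here q = q
walk-++ (step e p) q = step e (walk-++ p q)

walk-map : (G H : Graph) (φ : V G → V H) → (∀ {u v} → E G u v → E H (φ u) (φ v)) →
  ∀ {u v k} → Walk G u v k → Walk H (φ u) (φ v) k
walk-map G H φ φ-edge here = here
walk-map G H φ φ-edge (step e p) = step (φ-edge e) (walk-map G H φ φ-edge p)

Undirected : Graph → Set
Undirected G = ∀ {u v} → E G u v → E G v u

walk-reverse : ∀ {G : Graph} → Undirected G → ∀ {u v k} → Walk G u v k → Walk G v u k
walk-reverse sym-E here = here
walk-reverse {G} sym-E {k = suc k} (step e p) =
  subst (Walk G _ _) (+-comm k 1) (walk-++ (walk-reverse sym-E p) (step (sym-E e) here))

record IsPathMetric (G : Graph) (δ : V G → V G → ℕ) : Set where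
  field
    geodesic : ∀ u v → Walk G u v (δ u v)
    shortest : ∀ {u v m} → Walk G u v m → δ u v ≤ m
open IsPathMetric public

path-metric : ∀ {G : Graph} (δ : V G → V G → ℕ) → (∀ a → δ a a ≡ 0) →
  (∀ {u w} v → E G u w → δ u v ≤ suc (δ w v)) →
  (∀ u v → Walk G u v (δ u v)) → IsPathMetric G δ
path-metric {G} δ δ-diag δ-edge walks = record { geodesic = walks ; shortest = bound }
  where
  bound : ∀ {u v m} → Walk G u v m → δ u v ≤ m
  bound {u} here = ≤-reflexive (δ-diag u)
  bound {v = v} (step e p) = ≤-trans (δ-edge v e) (s≤s (bound p))

module _ {G : Graph} {δ : V G → V G → ℕ} (M : IsPathMetric G δ) where

  δ-diag : ∀ a → δ a a ≡ 0
  δ-diag a = n≤0⇒n≡0 (shortest M here)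

  δ-zero : ∀ {u v} → δ u v ≡ 0 → u ≡ v
  δ-zero {u} {v} eq with subst (Walk G u v) eq (geodesic M u v)
  ... | here = refl

  δ-edge : ∀ {u v} → E G u v → δ u v ≤ 1
  δ-edge e = shortest M (step e here)

  Dist⇔δ : ∀ {u v k} → Dist G u v k ⇔ (k ≡ δ u v)
  Dist⇔δ {u} {v} = mk⇔ (λ (w , min) → ≤-antisym (min _ (geodesic M u v)) (shortest M w))
                        (λ { refl → geodesic M u v , λ m w → shortest M w })

  edge⇔unit : (∀ {u} → ¬ E G u u) → ∀ {u v} → E G u v ⇔ (δ u v ≡ 1)
  edge⇔unit loopless {u} {v} = mk⇔ to from
    where
    to : E G u v → δ u v ≡ 1
    to e with δ u v in eq | δ-edge e
    ... | 1 | _ = refl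
    ... | 0 | _ = ⊥-elim (loopless (subst (E G u) (sym (δ-zero eq)) e))
    ... | suc (suc _) | s≤s ()
    from : δ u v ≡ 1 → E G u v
    from eq with subst (Walk G u v) eq (geodesic M u v)
    ... | step e here = e

metric-cong : ∀ {G : Graph} {δ δ′} → (∀ u v → δ u v ≡ δ′ u v) → IsPathMetric G δ → IsPathMetric G δ′
metric-cong {G} eq M = record
  { geodesic = λ u v → subst (Walk G u v) (eq u v) (geodesic M u v)
  ; shortest = λ {u} {v} w → subst (_≤ _) (eq u v) (shortest M w) }

module _ {G H : Graph} {δG : V G → V G → ℕ} {δH : V H → V H → ℕ}
         (MG : IsPathMetric G δG) (MH : IsPathMetric H δH) (f : V G → V H) where

  isometry : (∀ u v → δH (f u) (f v) ≡ δG u v) → IsIsometricEmbedding G H f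
  isometry pres = injective , λ u v k → mk⇔
    (λ d → Equivalence.from (Dist⇔δ MH) (trans (Equivalence.to (Dist⇔δ MG) d) (sym (pres u v))))
    (λ d → Equivalence.from (Dist⇔δ MG) (trans (Equivalence.to (Dist⇔δ MH) d) (pres u v)))
    where
    injective : ∀ {x y} → f x ≡ f y → x ≡ y
    injective {x} {y} fx≡fy = δ-zero MG (begin
      δG x y           ≡⟨ pres x y ⟨
      δH (f x) (f y)   ≡⟨ cong (δH (f x)) fx≡fy ⟨
      δH (f x) (f x)   ≡⟨ δ-diag MH (f x) ⟩
      0                ∎)
      where open ≡-Reasoning

  isometry-preserves : IsIsometricEmbedding G H f → ∀ u v → δH (f u) (f v) ≡ δG u v
  isometry-preserves (_ , dist) u v =
    sym (Equivalence.to (Dist⇔δ MH) (Equivalence.to (dist u v _) (Equivalence.from (Dist⇔δ MG) refl)))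

pullback-metric : ∀ {G H : Graph} {δH} → IsPathMetric H δH → (f : V G → V H) →
  IsIsometricEmbedding G H f → IsPathMetric G (λ u v → δH (f u) (f v))
pullback-metric {G} {H} {δH} MH f (_ , dist) = record
  { geodesic = λ u v → proj₁ (D u v) ; shortest = λ w → proj₂ (D _ _) _ w }
  where
  D : ∀ u v → Dist G u v (δH (f u) (f v))
  D u v = Equivalence.from (dist u v _) (Equivalence.from (Dist⇔δ MH) refl)

iso-metric : ∀ {G H : Graph} {δH} → IsPathMetric H δH → (iso : Isomorphic G H) →
  IsPathMetric G (λ u v → δH (proj₁ iso u) (proj₁ iso v))
iso-metric {G} {H} {δH} MH (φ , φ-inj , φ-surj , φ-edge) = record { geodesic = walks ; shortest = bound }
  where
  ψ : V H → V G
  ψ y = proj₁ (φ-surj y)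
  φψ : ∀ y → φ (ψ y) ≡ y
  φψ y = proj₂ (φ-surj y)
  ψ-edge : ∀ {y y′} → E H y y′ → E G (ψ y) (ψ y′)
  ψ-edge {y} {y′} e = Equivalence.from (φ-edge (ψ y) (ψ y′)) (subst₂ (E H) (sym (φψ y)) (sym (φψ y′)) e)
  walks : ∀ u v → Walk G u v (δH (φ u) (φ v))
  walks u v = subst₂ (λ s t → Walk G s t _) (φ-inj (φψ (φ u))) (φ-inj (φψ (φ v)))
    (walk-map H G ψ ψ-edge (geodesic MH (φ u) (φ v)))
  bound : ∀ {u v m} → Walk G u v m → δH (φ u) (φ v) ≤ m
  bound w = shortest MH (walk-map G H φ (λ {u} {v} → Equivalence.to (φ-edge u v)) w)

l1-self : ∀ {ℓ} (x : Vec ℤ ℓ) → l1 x x ≡ 0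
l1-self [] = refl
l1-self (x ∷ xs) = cong₂ _+_ (cong ℤ.∣_∣ (ℤP.+-inverseʳ x)) (l1-self xs)

l1-sym : ∀ {ℓ} (x y : Vec ℤ ℓ) → l1 x y ≡ l1 y x
l1-sym [] [] = refl
l1-sym (x ∷ xs) (y ∷ ys) = cong₂ _+_ (ℤP.∣i-j∣≡∣j-i∣ x y) (l1-sym xs ys)

∣-∣ℤ-triangle : ∀ a b c → ℤ.∣ a ℤ.- c ∣ ≤ ℤ.∣ a ℤ.- b ∣ + ℤ.∣ b ℤ.- c ∣
∣-∣ℤ-triangle a b c =
  subst (λ d → ℤ.∣ d ∣ ≤ ℤ.∣ a ℤ.- b ∣ + ℤ.∣ b ℤ.- c ∣) (split a b c) (ℤP.∣i+j∣≤∣i∣+∣j∣ (a ℤ.- b) (b ℤ.- c))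
  where
  split : ∀ a b c → (a ℤ.- b) ℤ.+ (b ℤ.- c) ≡ a ℤ.- c
  split = ℤSolver.solve-∀

l1-triangle : ∀ {ℓ} (x y z : Vec ℤ ℓ) → l1 x z ≤ l1 x y + l1 y z
l1-triangle [] [] [] = z≤n
l1-triangle (a ∷ xs) (b ∷ ys) (c ∷ zs) = ≤-trans
  (+-mono-≤ (∣-∣ℤ-triangle a b c) (l1-triangle xs ys zs))
  (≤-reflexive (interchange ℤ.∣ a ℤ.- b ∣ ℤ.∣ b ℤ.- c ∣ (l1 xs ys) (l1 ys zs)))

lattice-undirected : ∀ {ℓ} → Undirected (Lattice ℓ)
lattice-undirected {u = u} {v} e = trans (l1-sym v u) e

axis-walk : ∀ {ℓ} (xs : Vec ℤ ℓ) (x : ℤ) n → Walk (Lattice (suc ℓ)) (x ∷ xs) ((x ℤ.+ ℤ.+ n) ∷ xs) n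
axis-walk xs x zero = subst (λ z → Walk (Lattice _) (x ∷ xs) (z ∷ xs) 0) (sym (ℤP.+-identityʳ x)) here
axis-walk xs x (suc n) = step unit (subst (λ z → Walk (Lattice _) _ (z ∷ xs) n)
  (ℤP.+-assoc x (ℤ.+ 1) (ℤ.+ n)) (axis-walk xs (x ℤ.+ ℤ.+ 1) n))
  where
  one-back : ∀ x → x ℤ.- (x ℤ.+ ℤ.+ 1) ≡ ℤ.- ℤ.+ 1
  one-back = ℤSolver.solve-∀
  unit : l1 (x ∷ xs) ((x ℤ.+ ℤ.+ 1) ∷ xs) ≡ 1
  unit = cong₂ _+_ (cong ℤ.∣_∣ (one-back x)) (l1-self xs)

ascending-walk : ∀ {ℓ} (xs : Vec ℤ ℓ) {x y} → x ℤ.≤ y → Walk (Lattice (suc ℓ)) (x ∷ xs) (y ∷ xs) ℤ.∣ y ℤ.- x ∣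
ascending-walk xs {x} {y} x≤y = subst (λ z → Walk (Lattice _) (x ∷ xs) (z ∷ xs) ℤ.∣ y ℤ.- x ∣) arrive (axis-walk xs x ℤ.∣ y ℤ.- x ∣)
  where
  cancel : ∀ x y → x ℤ.+ (y ℤ.- x) ≡ y
  cancel = ℤSolver.solve-∀
  arrive : x ℤ.+ ℤ.+ ℤ.∣ y ℤ.- x ∣ ≡ y
  arrive = trans (cong (λ d → x ℤ.+ d) (ℤP.0≤i⇒+∣i∣≡i (ℤP.i≤j⇒0≤j-i x≤y))) (cancel x y)

coordinate-walk : ∀ {ℓ} (xs : Vec ℤ ℓ) x y → Walk (Lattice (suc ℓ)) (x ∷ xs) (y ∷ xs) ℤ.∣ x ℤ.- y ∣
coordinate-walk xs x y with ℤP.≤-total x y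
... | inj₁ x≤y = subst (Walk (Lattice _) _ _) (ℤP.∣i-j∣≡∣j-i∣ y x) (ascending-walk xs x≤y)
... | inj₂ y≤x = walk-reverse (λ {u} {v} → lattice-undirected {u = u} {v}) (ascending-walk xs y≤x)

cons-walk : ∀ {ℓ} (c : ℤ) {xs ys : Vec ℤ ℓ} {k} → Walk (Lattice ℓ) xs ys k → Walk (Lattice (suc ℓ)) (c ∷ xs) (c ∷ ys) k
cons-walk c = walk-map (Lattice _) (Lattice _) (c ∷_) (cong₂ _+_ (cong ℤ.∣_∣ (ℤP.+-inverseʳ c)))

lattice-walk : ∀ {ℓ} (x y : Vec ℤ ℓ) → Walk (Lattice ℓ) x y (l1 x y)
lattice-walk [] [] = here
lattice-walk (x ∷ xs) (y ∷ ys) = walk-++ (coordinate-walk xs x y) (cons-walk y (lattice-walk xs ys))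

-- l1 drops by at most one along an edge by the triangle inequality.
lattice-metric : ∀ ℓ → IsPathMetric (Lattice ℓ) l1
lattice-metric ℓ = path-metric l1 l1-self
  (λ {u} {w} v e → subst (λ d → l1 u v ≤ d + l1 w v) e (l1-triangle u w v)) lattice-walk

∣+m-+n∣ : ∀ m n → ℤ.∣ ℤ.+ m ℤ.- ℤ.+ n ∣ ≡ ∣ m - n ∣
∣+m-+n∣ m n with ≤-total m n
... | inj₁ m≤n = trans (cong ℤ.∣_∣ (ℤP.m-n≡m⊖n m n)) (trans (ℤP.∣⊖∣-≤ m≤n) (sym (m≤n⇒∣m-n∣≡n∸m m≤n)))
... | inj₂ n≤m = trans (cong ℤ.∣_∣ (ℤP.m-n≡m⊖n m n))
  (trans (ℤP.∣m⊖n∣≡∣n⊖m∣ m n) (trans (ℤP.∣⊖∣-≤ n≤m) (sym (m≤n⇒∣n-m∣≡n∸m n≤m))))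

-- The path metric of both Q_m and Γ_m is the Hamming distance.

ham-same : ∀ {m} c (x y : Vec Bool m) → hamming (c ∷ x) (c ∷ y) ≡ hamming x y
ham-same false x y = refl
ham-same true x y = refl

ham-self : ∀ {m} (x : Vec Bool m) → hamming x x ≡ 0
ham-self [] = refl
ham-self (c ∷ x) = trans (ham-same c x x) (ham-self x)

ham-zero : ∀ {m} {x y : Vec Bool m} → hamming x y ≡ 0 → x ≡ y
ham-zero {x = []} {[]} eq = refl
ham-zero {x = false ∷ x} {false ∷ y} eq = cong (false ∷_) (ham-zero eq)
ham-zero {x = true ∷ x} {true ∷ y} eq = cong (true ∷_) (ham-zero eq)

ham-sym : ∀ {m} (x y : Vec Bool m) → hamming x y ≡ hamming y x
ham-sym [] [] = refl
ham-sym (false ∷ x) (false ∷ y) = ham-sym x y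
ham-sym (false ∷ x) (true ∷ y) = cong suc (ham-sym x y)
ham-sym (true ∷ x) (false ∷ y) = cong suc (ham-sym x y)
ham-sym (true ∷ x) (true ∷ y) = ham-sym x y

ham-triangle : ∀ {m} (x y z : Vec Bool m) → hamming x z ≤ hamming x y + hamming y z
ham-triangle [] [] [] = z≤n
ham-triangle (a ∷ x) (b ∷ y) (c ∷ z) with a | b | c
... | false | false | false = ham-triangle x y z
... | true  | true  | true  = ham-triangle x y z
... | false | true  | true  = s≤s (ham-triangle x y z)
... | true  | false | false = s≤s (ham-triangle x y z)
... | false | false | true  = ≤-trans (s≤s (ham-triangle x y z)) (≤-reflexive (sym (+-suc _ _)))
... | true  | true  | false = ≤-trans (s≤s (ham-triangle x y z)) (≤-reflexive (sym (+-suc _ _)))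
... | false | true  | false = ≤-trans (ham-triangle x y z) (≤-trans (n≤1+n _) (s≤s (+-monoʳ-≤ _ (n≤1+n _))))
... | true  | false | true  = ≤-trans (ham-triangle x y z) (≤-trans (n≤1+n _) (s≤s (+-monoʳ-≤ _ (n≤1+n _))))

ham-edge : ∀ {m} {u w : Vec Bool m} v → hamming u w ≡ 1 → hamming u v ≤ suc (hamming w v)
ham-edge {u = u} {w} v e = subst (λ d → hamming u v ≤ d + hamming w v) e (ham-triangle u w v)

subcube-walk : ∀ {m} c {x y : Vec Bool m} {k} → Walk (Cube m) x y k → Walk (Cube (suc m)) (c ∷ x) (c ∷ y) k
subcube-walk c = walk-map (Cube _) (Cube _) (c ∷_) (λ {u} {v} e → trans (ham-same c u v) e)

cube-walk : ∀ {m} (x y : Vec Bool m) → Walk (Cube m) x y (hamming x y)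
cube-walk [] [] = here
cube-walk (a ∷ x) (b ∷ y) with a | b
... | false | false = subcube-walk false (cube-walk x y)
... | true  | true  = subcube-walk true (cube-walk x y)
... | false | true  = step (cong suc (ham-self x)) (subcube-walk true (cube-walk x y))
... | true  | false = step (cong suc (ham-self x)) (subcube-walk false (cube-walk x y))

cube-metric : ∀ m → IsPathMetric (Cube m) hamming
cube-metric m = path-metric hamming ham-self (λ {u} {w} v → ham-edge {u = u} {w} v) cube-walk

_⊑_ : ∀ {m} → Vec Bool m → Vec Bool m → Set
[] ⊑ [] = ⊤
(a ∷ x) ⊑ (b ∷ y) = a Bool.≤ b × x ⊑ y

⊑-refl : ∀ {m} (x : Vec Bool m) → x ⊑ x
⊑-refl [] = tt
⊑-refl (a ∷ x) = Bool.b≤b , ⊑-refl x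

Fib-tail : ∀ {m} b (y : Vec Bool m) → Fib (b ∷ y) → Fib y
Fib-tail false y f = f
Fib-tail true [] f = tt
Fib-tail true (false ∷ y) f = f

Fib-mono : ∀ {m} {x y : Vec Bool m} → x ⊑ y → Fib y → Fib x
Fib-mono {x = []} {[]} _ _ = tt
Fib-mono {x = false ∷ x} {b ∷ y} (_ , x⊑y) f = Fib-mono x⊑y (Fib-tail b y f)
Fib-mono {x = true ∷ []} {true ∷ []} _ _ = tt
Fib-mono {x = true ∷ false ∷ x} {true ∷ false ∷ y} (_ , _ , x⊑y) f = Fib-mono x⊑y f

-- Being a Fibonacci string is a proposition, so vertices of Γ_m are determined by their string.
Fib-irrelevant : ∀ {m} {x : Vec Bool m} (p q : Fib x) → p ≡ q
Fib-irrelevant {x = []} p q = refl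
Fib-irrelevant {x = false ∷ x} p q = Fib-irrelevant {x = x} p q
Fib-irrelevant {x = true ∷ []} p q = refl
Fib-irrelevant {x = true ∷ false ∷ x} p q = Fib-irrelevant {x = x} p q

_⊓_ : ∀ {m} → Vec Bool m → Vec Bool m → Vec Bool m
[] ⊓ [] = []
(a ∷ x) ⊓ (b ∷ y) = (a Bool.∧ b) ∷ (x ⊓ y)

⊓-⊑ˡ : ∀ {m} (x y : Vec Bool m) → (x ⊓ y) ⊑ x
⊓-⊑ˡ [] [] = tt
⊓-⊑ˡ (false ∷ x) (b ∷ y) = Bool.b≤b , ⊓-⊑ˡ x y
⊓-⊑ˡ (true ∷ x) (false ∷ y) = Bool.f≤t , ⊓-⊑ˡ x y
⊓-⊑ˡ (true ∷ x) (true ∷ y) = Bool.b≤b , ⊓-⊑ˡ x y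

⊓-⊑ʳ : ∀ {m} (x y : Vec Bool m) → (x ⊓ y) ⊑ y
⊓-⊑ʳ [] [] = tt
⊓-⊑ʳ (false ∷ x) (false ∷ y) = Bool.b≤b , ⊓-⊑ʳ x y
⊓-⊑ʳ (false ∷ x) (true ∷ y) = Bool.f≤t , ⊓-⊑ʳ x y
⊓-⊑ʳ (true ∷ x) (b ∷ y) = Bool.b≤b , ⊓-⊑ʳ x y

ham-meet : ∀ {m} (x y : Vec Bool m) → hamming x (x ⊓ y) + hamming (x ⊓ y) y ≡ hamming x y
ham-meet [] [] = refl
ham-meet (false ∷ x) (false ∷ y) = ham-meet x y
ham-meet (false ∷ x) (true ∷ y) = trans (+-suc _ _) (cong suc (ham-meet x y))
ham-meet (true ∷ x) (false ∷ y) = cong suc (ham-meet x y)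
ham-meet (true ∷ x) (true ∷ y) = ham-meet x y

clear-one : ∀ {m k} {x z : Vec Bool m} → z ⊑ x → hamming x z ≡ suc k →
  Σ (Vec Bool m) λ x′ → hamming x x′ ≡ 1 × z ⊑ x′ × x′ ⊑ x × hamming x′ z ≡ k
clear-one {x = []} {[]} _ ()
clear-one {x = true ∷ x} {false ∷ z} (Bool.f≤t , z⊑x) eq =
  false ∷ x , cong suc (ham-self x) , (Bool.b≤b , z⊑x) , (Bool.f≤t , ⊑-refl x) , suc-injective eq
clear-one {x = c ∷ x} {c ∷ z} (Bool.b≤b , z⊑x) eq with clear-one z⊑x (trans (sym (ham-same c x z)) eq)
... | x′ , adj , z⊑x′ , x′⊑x , closer =
  c ∷ x′ , trans (ham-same c x x′) adj , (Bool.b≤b , z⊑x′) , (Bool.b≤b , x′⊑x) , trans (ham-same c x′ z) closer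

descending-walk : ∀ {m} k {x z : Vec Bool m} (fx : Fib x) (fz : Fib z) → z ⊑ x → hamming x z ≡ k →
  Walk (FibCube m) (x , fx) (z , fz) k
descending-walk zero {x} {z} fx fz _ eq with ham-zero {x = x} {z} eq
... | refl = subst (λ p → Walk (FibCube _) (x , fx) (x , p) 0) (Fib-irrelevant {x = x} fx fz) here
descending-walk (suc k) fx fz z⊑x eq with clear-one z⊑x eq
... | x′ , adj , z⊑x′ , x′⊑x , closer = step adj (descending-walk k (Fib-mono x′⊑x fx) fz z⊑x′ closer)

fib-undirected : ∀ {m} → Undirected (FibCube m)
fib-undirected {u = u} {v} e = trans (ham-sym (proj₁ v) (proj₁ u)) e

-- Going down from x to x ⊓ y and up again to y.
fib-walk : ∀ {m} (x y : V (FibCube m)) → Walk (FibCube m) x y (hamming (proj₁ x) (proj₁ y))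
fib-walk (x , fx) (y , fy) = subst (Walk (FibCube _) _ _) (ham-meet x y)
  (walk-++ (descending-walk _ fx f⊓ (⊓-⊑ˡ x y) refl)
           (walk-reverse (λ {u} {v} → fib-undirected {u = u} {v}) (descending-walk _ fy f⊓ (⊓-⊑ʳ x y) (ham-sym y (x ⊓ y)))))
  where
  f⊓ : Fib (x ⊓ y)
  f⊓ = Fib-mono (⊓-⊑ˡ x y) fx

fib-metric : ∀ m → IsPathMetric (FibCube m) (λ x y → hamming (proj₁ x) (proj₁ y))
fib-metric m = path-metric _ (λ x → ham-self (proj₁ x)) (λ {u} {w} v → ham-edge {u = proj₁ u} {proj₁ w} (proj₁ v)) fib-walk

isometry-∘ : ∀ {G H K : Graph} {f : V G → V H} {g : V H → V K} →
  IsIsometricEmbedding G H f → IsIsometricEmbedding H K g → IsIsometricEmbedding G K (λ v → g (f v))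
isometry-∘ (f-inj , f-dist) (g-inj , g-dist) =
  (λ eq → f-inj (g-inj eq)) , λ u v k → mk⇔
    (λ d → Equivalence.to (g-dist _ _ k) (Equivalence.to (f-dist u v k) d))
    (λ d → Equivalence.from (f-dist u v k) (Equivalence.from (g-dist _ _ k) d))

-- Γ_m is an isometric subgraph of Q_m, so fdim bounds idim from above.
fib→cube : ∀ {G : Graph} {m} → Embeds G (FibCube m) → Embeds G (Cube m)
fib→cube {m = m} (f , f-iso) =
  (λ v → proj₁ (f v)) , isometry-∘ f-iso (isometry (fib-metric m) (cube-metric m) proj₁ (λ _ _ → refl))

-- Djoković's relation Θ bounds the isometric dimension from below.

-- Edges uv and u′v′ of a metric space are in Djoković's relation Θ unless both
-- ways of pairing their ends have the same total length.
Θ-free : ∀ {A : Set} → (A → A → ℕ) → A → A → A → A → Set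
Θ-free δ u v u′ v′ = δ u v′ + δ v u′ ≡ δ u u′ + δ v v′

Θ-free-transport : ∀ {A B : Set} {δ : A → A → ℕ} {δ′ : B → B → ℕ} (f : A → B) →
  (∀ a b → δ′ (f a) (f b) ≡ δ a b) → ∀ {u v u′ v′} → Θ-free δ u v u′ v′ → Θ-free δ′ (f u) (f v) (f u′) (f v′)
Θ-free-transport f pres {u} {v} {u′} {v′} free =
  trans (cong₂ _+_ (pres u v′) (pres v u′)) (trans free (sym (cong₂ _+_ (pres u u′) (pres v v′))))

flip : ∀ {m} → Vec Bool m → Fin m → Vec Bool m
flip (a ∷ x) Fin.zero = not a ∷ x
flip (a ∷ x) (Fin.suc d) = a ∷ flip x d

flip-involutive : ∀ {m} (x : Vec Bool m) d → flip (flip x d) d ≡ x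
flip-involutive (a ∷ x) Fin.zero = cong (_∷ x) (BoolP.not-involutive a)
flip-involutive (a ∷ x) (Fin.suc d) = cong (a ∷_) (flip-involutive x d)

edge-flips : ∀ {m} (x y : Vec Bool m) → hamming x y ≡ 1 → Σ (Fin m) λ d → y ≡ flip x d
edge-flips [] [] ()
edge-flips (a ∷ x) (b ∷ y) eq with a | b
... | false | false = let d , y≡ = edge-flips x y eq in Fin.suc d , cong (false ∷_) y≡
... | true  | true  = let d , y≡ = edge-flips x y eq in Fin.suc d , cong (true ∷_) y≡
... | false | true  = Fin.zero , cong (true ∷_) (sym (ham-zero (suc-injective eq)))
... | true  | false = Fin.zero , cong (false ∷_) (sym (ham-zero (suc-injective eq)))

ham-flip-flip : ∀ {m} (x y : Vec Bool m) d → hamming (flip x d) (flip y d) ≡ hamming x y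
ham-flip-flip (a ∷ x) (b ∷ y) d with a | b | d
... | false | false | Fin.zero = refl
... | false | true  | Fin.zero = refl
... | true  | false | Fin.zero = refl
... | true  | true  | Fin.zero = refl
... | false | false | Fin.suc d = ham-flip-flip x y d
... | false | true  | Fin.suc d = cong suc (ham-flip-flip x y d)
... | true  | false | Fin.suc d = cong suc (ham-flip-flip x y d)
... | true  | true  | Fin.suc d = ham-flip-flip x y d

ham-flip-≢ : ∀ {m} (x y : Vec Bool m) d → hamming x (flip y d) ≢ hamming x y
ham-flip-≢ (a ∷ x) (b ∷ y) d with a | b | d
... | false | false | Fin.zero = 1+n≢n
... | false | true  | Fin.zero = 1+n≢n ∘ sym
... | true  | false | Fin.zero = 1+n≢n ∘ sym
... | true  | true  | Fin.zero = 1+n≢n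
... | false | false | Fin.suc d = ham-flip-≢ x y d
... | false | true  | Fin.suc d = ham-flip-≢ x y d ∘ suc-injective
... | true  | false | Fin.suc d = ham-flip-≢ x y d ∘ suc-injective
... | true  | true  | Fin.suc d = ham-flip-≢ x y d

double-injective : ∀ s h → s + s ≡ h + h → s ≡ h
double-injective s h eq = *-cancelˡ-≡ s h 2
  (trans (cong (s +_) (+-identityʳ s)) (trans eq (sym (cong (h +_) (+-identityʳ h)))))

flip-Θ : ∀ {m} (x y : Vec Bool m) d → ¬ Θ-free hamming x (flip x d) y (flip y d)
flip-Θ x y d free = ham-flip-≢ x y d (double-injective s h (begin
  s + s                                 ≡⟨ cong (s +_) flip-sides ⟩
  s + hamming (flip x d) y              ≡⟨ free ⟩
  h + hamming (flip x d) (flip y d)     ≡⟨ cong (h +_) (ham-flip-flip x y d) ⟩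
  h + h                                 ∎))
  where
  open ≡-Reasoning
  s = hamming x (flip y d)
  h = hamming x y
  flip-sides : hamming x (flip y d) ≡ hamming (flip x d) y
  flip-sides = trans (sym (ham-flip-flip x (flip y d) d)) (cong (hamming (flip x d)) (flip-involutive y d))

-- Pairwise Θ-free edges of an isometric subgraph of Q_m flip pairwise
-- different coordinates; hence there are at most m of them.
Θ-free-bound : ∀ {G : Graph} {δ k m} → IsPathMetric G δ → (u v : Fin k → V G) →
  (∀ c → δ (u c) (v c) ≡ 1) → (∀ c c′ → c ≢ c′ → Θ-free δ (u c) (v c) (u c′) (v c′)) →
  Embeds G (Cube m) → k ≤ m
Θ-free-bound {δ = δ} {m = m} M u v unit free (f , f-iso) = FinP.injective⇒≤ direction-injective
  where
  pres : ∀ a b → hamming (f a) (f b) ≡ δ a b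
  pres = isometry-preserves M (cube-metric m) f f-iso
  flips : ∀ c → Σ (Fin m) λ d → f (v c) ≡ flip (f (u c)) d
  flips c = edge-flips _ _ (trans (pres (u c) (v c)) (unit c))
  direction : _ → Fin m
  direction c = proj₁ (flips c)
  direction-injective : ∀ {c c′} → direction c ≡ direction c′ → c ≡ c′
  direction-injective {c} {c′} same with c Fin.≟ c′
  ... | yes c≡c′ = c≡c′
  ... | no c≢c′ = ⊥-elim (flip-Θ (f (u c)) (f (u c′)) (direction c)
    (subst₂ (λ y y′ → Θ-free hamming (f (u c)) y (f (u c′)) y′) (proj₂ (flips c))
      (trans (proj₂ (flips c′)) (cong (flip (f (u c′))) (sym same)))
      (Θ-free-transport {δ′ = hamming} f pres (free c c′ c≢c′))))

-- Rectilinear coordinates: the path metric as an ℓ¹ distance in a box of ℕ².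

crossing-edge : ∀ {G : Graph} {u v k} → Walk G u v k → (h : V G → ℕ) → ∀ {i} → h u ≤ i → i < h v →
  Σ (V G) λ x → Σ (V G) λ y → E G x y × h x ≤ i × i < h y
crossing-edge here h u≤i i<u = ⊥-elim (<-irrefl refl (≤-<-trans u≤i i<u))
crossing-edge (step {u} {w} e rest) h {i} u≤i i<v with i <? h w
... | yes i<w = u , w , e , u≤i , i<w
... | no i≮w = crossing-edge rest h (≮⇒≥ i≮w) i<v

visit-level : ∀ {G : Graph} {u v k} → Walk G u v k → (h : V G → ℕ) → (∀ {x y} → E G x y → h y ≤ suc (h x)) →
  ∀ {j} → h u ≤ j → j ≤ h v →
  Σ (V G) λ x → Σ ℕ λ k₁ → Σ ℕ λ k₂ → Walk G u x k₁ × Walk G x v k₂ × k₁ + k₂ ≡ k × h x ≡ j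
visit-level here h rise u≤j j≤u = _ , 0 , 0 , here , here , refl , ≤-antisym u≤j j≤u
visit-level (step {u} e rest) h rise {j} u≤j j≤v with h u ≟ j
... | yes u≡j = u , 0 , _ , here , step e rest , refl , u≡j
... | no u≢j with visit-level rest h rise (≤-trans (rise e) (≤∧≢⇒< u≤j u≢j)) j≤v
...   | x , k₁ , k₂ , w₁ , w₂ , total , x≡j = x , suc k₁ , k₂ , step e w₁ , w₂ , cong suc total , x≡j

rect : ∀ {A : Set} → (A → ℕ) → (A → ℕ) → A → A → ℕ
rect α β u v = ∣ α u - α v ∣ + ∣ β u - β v ∣

record Coordinates (G : Graph) (p q : ℕ) : Set where
  field
    α β : V G → ℕ
    α≤p : ∀ v → α v ≤ p
    β≤q : ∀ v → β v ≤ q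
    rect-metric : IsPathMetric G (rect α β)

Corner : ∀ {G p q} → Coordinates G p q → ℕ → ℕ → Set
Corner {G} C i j = Σ (V G) λ v → Coordinates.α C v ≡ i × Coordinates.β C v ≡ j

swap : ∀ {G p q} → Coordinates G p q → Coordinates G q p
swap C = record { α = β ; β = α ; α≤p = β≤q ; β≤q = α≤p
                ; rect-metric = metric-cong (λ u v → +-comm ∣ α u - α v ∣ _) rect-metric }
  where open Coordinates C

reflect-dist : ∀ r a b → a ≤ r → b ≤ r → ∣ (r ∸ a) - (r ∸ b) ∣ ≡ ∣ a - b ∣
reflect-dist r zero zero _ _ = ∣n-n∣≡0 r
reflect-dist (suc r) (suc a) (suc b) (s≤s a≤r) (s≤s b≤r) = reflect-dist r a b a≤r b≤r
reflect-dist r zero (suc b) _ b<r = trans (m≤n⇒∣n-m∣≡n∸m (m∸n≤m r (suc b))) (m∸[m∸n]≡n b<r)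
reflect-dist r (suc a) zero a<r _ = trans (m≤n⇒∣m-n∣≡n∸m (m∸n≤m r (suc a))) (m∸[m∸n]≡n a<r)

reflect : ∀ {G p q} → Coordinates G p q → Coordinates G p q
reflect {p = p} C = record { α = λ v → p ∸ α v ; β = β ; α≤p = λ v → m∸n≤m p (α v) ; β≤q = β≤q
  ; rect-metric = metric-cong (λ u v → cong (_+ ∣ β u - β v ∣) (sym (reflect-dist p _ _ (α≤p u) (α≤p v)))) rect-metric }
  where open Coordinates C

reflect-corner : ∀ {G p q} (C : Coordinates G p q) {j} → Corner (reflect C) p j → Corner C 0 j
reflect-corner {p = p} C (v , αv , βv) = v , trans (sym (m∸[m∸n]≡n (α≤p v))) (trans (cong (p ∸_) αv) (n∸n≡0 p)) , βv
  where open Coordinates C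

relax : ∀ {G p q} → Coordinates G p q → Coordinates G p (suc q)
relax C = record { α = α ; β = β ; α≤p = α≤p ; β≤q = λ v → m≤n⇒m≤1+n (β≤q v) ; rect-metric = rect-metric }
  where open Coordinates C

unit-step : ∀ {x y s} → ∣ x - y ∣ + s ≤ 1 → x < y → y ≡ suc x × s ≡ 0
unit-step {zero} {suc y} (s≤s le) _ = cong suc (m+n≡0⇒m≡0 y (n≤0⇒n≡0 le)) , m+n≡0⇒n≡0 y (n≤0⇒n≡0 le)
unit-step {suc x} {suc y} le (s≤s x<y) = let y≡ , s≡0 = unit-step le x<y in cong suc y≡ , s≡0

dist-split : ∀ m j n → m ≤ j → j ≤ n → ∣ m - n ∣ ≡ ∣ m - j ∣ + ∣ j - n ∣
dist-split zero j n _ j≤n = trans (sym (m+[n∸m]≡n j≤n)) (cong (j +_) (sym (m≤n⇒∣m-n∣≡n∸m j≤n)))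
dist-split (suc m) (suc j) (suc n) (s≤s m≤j) (s≤s j≤n) = dist-split m j n m≤j j≤n

no-detour : ∀ a b a′ c → (a + b) + (a′ + c) ≤ b + c → a ≡ 0
no-detour a b a′ c le = n≤0⇒n≡0 (m+n≤o⇒m≤o a (+-cancelʳ-≤ (b + c) (a + a′) 0 (subst (_≤ b + c) (interchange a b a′ c) le)))

module _ {G : Graph} {p q} (C : Coordinates G p q) where
  open Coordinates C

  Horizontal : ℕ → V G → V G → Set
  Horizontal i x y = α x ≡ i × α y ≡ suc (α x) × β y ≡ β x

  climbing-edge : ∀ {x y i} → E G x y → α x ≤ i → i < α y → Horizontal i x y
  climbing-edge e x≤i i<y with unit-step (δ-edge rect-metric e) (≤-<-trans x≤i i<y)
  ... | y≡ , flat = ≤-antisym x≤i (≤-pred (subst (_ <_) y≡ i<y)) , y≡ , sym (∣m-n∣≡0⇒m≡n flat)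

  β-rise : ∀ {x y} → E G x y → β y ≤ suc (β x)
  β-rise {x} {y} e = begin
    β y                   ≤⟨ m≤n+∣m-n∣ (β y) (β x) ⟩
    β x + ∣ β y - β x ∣   ≤⟨ +-monoʳ-≤ (β x) (subst (_≤ 1) (∣-∣-comm (β x) (β y)) (m+n≤o⇒n≤o _ (δ-edge rect-metric e))) ⟩
    β x + 1               ≡⟨ +-comm (β x) 1 ⟩
    suc (β x)             ∎
    where open ≤-Reasoning

  fill-segment : ∀ {u v j} → α u ≡ α v → β u ≤ j → j ≤ β v → Σ (V G) λ x → α x ≡ α u × β x ≡ j
  fill-segment {u} {v} {j} αu≡αv u≤j j≤v with visit-level (geodesic rect-metric u v) β β-rise u≤j j≤v
  ... | x , k₁ , k₂ , w₁ , w₂ , total , refl =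
    x , sym (∣m-n∣≡0⇒m≡n (no-detour ∣ α u - α x ∣ ∣ β u - β x ∣ ∣ α x - α v ∣ ∣ β x - β v ∣ x-on-geodesic)) , refl
    where
    open ≤-Reasoning
    -- x lies on a geodesic from u to v, whose length is purely vertical
    x-on-geodesic : rect α β u x + rect α β x v ≤ ∣ β u - β x ∣ + ∣ β x - β v ∣
    x-on-geodesic = begin
      rect α β u x + rect α β x v   ≤⟨ +-mono-≤ (shortest rect-metric w₁) (shortest rect-metric w₂) ⟩
      k₁ + k₂                       ≡⟨ total ⟩
      rect α β u v                  ≡⟨ cong (_+ ∣ β u - β v ∣) (trans (cong (∣ α u -_∣) (sym αu≡αv)) (∣n-n∣≡0 (α u))) ⟩
      ∣ β u - β v ∣                 ≡⟨ dist-split (β u) (β x) (β v) u≤j j≤v ⟩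
      ∣ β u - β x ∣ + ∣ β x - β v ∣ ∎

line-embedding : ∀ {G : Graph} {q} → Coordinates G 0 q → Embeds G (Lattice 1)
line-embedding C = (λ v → ℤ.+ β v ∷ []) , isometry rect-metric (lattice-metric 1) _ on-line
  where
  open Coordinates C
  on-line : ∀ u v → l1 (ℤ.+ β u ∷ []) (ℤ.+ β v ∷ []) ≡ rect α β u v
  on-line u v = begin
    ℤ.∣ ℤ.+ β u ℤ.- ℤ.+ β v ∣ + 0   ≡⟨ +-identityʳ _ ⟩
    ℤ.∣ ℤ.+ β u ℤ.- ℤ.+ β v ∣       ≡⟨ ∣+m-+n∣ (β u) (β v) ⟩
    ∣ 0 - 0 ∣ + ∣ β u - β v ∣       ≡⟨ cong₂ (λ a b → ∣ a - b ∣ + ∣ β u - β v ∣) (n≤0⇒n≡0 (α≤p u)) (n≤0⇒n≡0 (α≤p v)) ⟨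
    rect α β u v                    ∎
    where open ≡-Reasoning

-- Fibonacci path codes, and the upper bounds on idim and fdim.

Head0 : ∀ {m} → Vec Bool m → Set
Head0 [] = ⊤
Head0 (b ∷ _) = b ≡ false

End0 : ∀ {m} → Vec Bool m → Set
End0 [] = ⊤
End0 (b ∷ []) = b ≡ false
End0 (_ ∷ c ∷ cs) = End0 (c ∷ cs)

End0-tail : ∀ {m} b (xs : Vec Bool m) → End0 (b ∷ xs) → End0 xs
End0-tail b [] _ = tt
End0-tail b (c ∷ cs) end = end

Fib-true : ∀ {m} (ys : Vec Bool m) → Fib ys → Head0 ys → Fib (true ∷ ys)
Fib-true [] _ _ = tt
Fib-true (false ∷ ys) f _ = f

Fib-true⇒Head0 : ∀ {m} (ys : Vec Bool m) → Fib (true ∷ ys) → Head0 ys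
Fib-true⇒Head0 [] _ = tt
Fib-true⇒Head0 (false ∷ ys) _ = refl

Fib-++ : ∀ {m k} (xs : Vec Bool m) (ys : Vec Bool k) → Fib xs → Fib ys → End0 xs ⊎ Head0 ys → Fib (xs ++ ys)
Fib-++ [] ys _ fy _ = fy
Fib-++ (false ∷ xs) ys fx fy (inj₁ end) = Fib-++ xs ys fx fy (inj₁ (End0-tail false xs end))
Fib-++ (false ∷ xs) ys fx fy (inj₂ head) = Fib-++ xs ys fx fy (inj₂ head)
Fib-++ (true ∷ []) ys _ fy (inj₂ head) = Fib-true ys fy head
Fib-++ (true ∷ false ∷ xs) ys fx fy (inj₁ end) = Fib-++ xs ys fx fy (inj₁ (End0-tail false xs end))
Fib-++ (true ∷ false ∷ xs) ys fx fy (inj₂ head) = Fib-++ xs ys fx fy (inj₂ head)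

ham-++ : ∀ {m k} (x x′ : Vec Bool m) (y y′ : Vec Bool k) → hamming (x ++ y) (x′ ++ y′) ≡ hamming x x′ + hamming y y′
ham-++ [] [] y y′ = refl
ham-++ (a ∷ x) (b ∷ x′) y y′ with a | b
... | false | false = ham-++ x x′ y y′
... | true  | true  = ham-++ x x′ y y′
... | false | true  = cong suc (ham-++ x x′ y y′)
... | true  | false = cong suc (ham-++ x x′ y y′)

ham-∷ʳ : ∀ {m} (x y : Vec Bool m) a b → hamming (x ∷ʳ a) (y ∷ʳ b) ≡ hamming x y + hamming [ a ] [ b ]
ham-∷ʳ [] [] a b = refl
ham-∷ʳ (c ∷ x) (d ∷ y) a b with c | d
... | false | false = ham-∷ʳ x y a b
... | true  | true  = ham-∷ʳ x y a b
... | false | true  = cong suc (ham-∷ʳ x y a b)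
... | true  | false = cong suc (ham-∷ʳ x y a b)

ham-∷ : ∀ {m} a b (x y : Vec Bool m) → hamming (a ∷ x) (b ∷ y) ≡ hamming x y + hamming [ a ] [ b ]
ham-∷ false false x y = sym (+-identityʳ _)
ham-∷ true  true  x y = sym (+-identityʳ _)
ham-∷ false true  x y = +-comm 1 _
ham-∷ true  false x y = +-comm 1 _

ham-reverse : ∀ {m} (x y : Vec Bool m) → hamming (reverse x) (reverse y) ≡ hamming x y
ham-reverse [] [] = refl
ham-reverse (a ∷ x) (b ∷ y) = begin
  hamming (reverse (a ∷ x)) (reverse (b ∷ y))   ≡⟨ cong₂ hamming (VecP.reverse-∷ a x) (VecP.reverse-∷ b y) ⟩
  hamming (reverse x ∷ʳ a) (reverse y ∷ʳ b)     ≡⟨ ham-∷ʳ (reverse x) (reverse y) a b ⟩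
  hamming (reverse x) (reverse y) + hamming [ a ] [ b ] ≡⟨ cong (_+ hamming [ a ] [ b ]) (ham-reverse x y) ⟩
  hamming x y + hamming [ a ] [ b ]             ≡⟨ ham-∷ a b x y ⟨
  hamming (a ∷ x) (b ∷ y)                       ∎
  where open ≡-Reasoning

End0-∷ʳ : ∀ {m} (xs : Vec Bool m) → End0 (xs ∷ʳ false)
End0-∷ʳ [] = refl
End0-∷ʳ (c ∷ []) = refl
End0-∷ʳ (c ∷ d ∷ ds) = End0-∷ʳ (d ∷ ds)

End0-reverse : ∀ {m} (xs : Vec Bool m) → Head0 xs → End0 (reverse xs)
End0-reverse [] _ = tt
End0-reverse (b ∷ xs) refl = subst End0 (sym (VecP.reverse-∷ false xs)) (End0-∷ʳ (reverse xs))

Fib-∷ʳ : ∀ {m} (xs : Vec Bool m) b → Fib xs → End0 xs ⊎ b ≡ false → Fib (xs ∷ʳ b)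
Fib-∷ʳ [] false _ _ = tt
Fib-∷ʳ [] true _ _ = tt
Fib-∷ʳ (false ∷ xs) b fx junction = Fib-∷ʳ xs b fx (⊎-map (End0-tail false xs) id junction)
Fib-∷ʳ (true ∷ []) .false _ (inj₂ refl) = tt
Fib-∷ʳ (true ∷ false ∷ xs) b fx junction =
  Fib-∷ʳ xs b fx (⊎-map (λ end → End0-tail false xs (End0-tail true (false ∷ xs) end)) id junction)

Fib-reverse : ∀ {m} (xs : Vec Bool m) → Fib xs → Fib (reverse xs)
Fib-reverse [] _ = tt
Fib-reverse (a ∷ xs) f = subst Fib (sym (VecP.reverse-∷ a xs)) (Fib-∷ʳ (reverse xs) a (Fib-reverse xs (Fib-tail a xs f)) (junction a f))
  where
  junction : ∀ a → Fib (a ∷ xs) → End0 (reverse xs) ⊎ a ≡ false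
  junction false _ = inj₂ refl
  junction true f = inj₁ (End0-reverse xs (Fib-true⇒Head0 xs f))

-- An isometric path of length p in the Fibonacci cube Γ_p.  The first bit is
-- set only at the far end x = p; the tail is the same code one dimension
-- lower, traversed backwards.
pathCode : (p : ℕ) → ℕ → Vec Bool p
pathCode zero x = []
pathCode (suc r) x = (x ≡ᵇ suc r) ∷ pathCode r (r ∸ x)

≡ᵇ-refl : ∀ n → (n ≡ᵇ n) ≡ true
≡ᵇ-refl zero = refl
≡ᵇ-refl (suc n) = ≡ᵇ-refl n

<⇒≡ᵇ-false : ∀ {m n} → m < n → (m ≡ᵇ n) ≡ false
<⇒≡ᵇ-false {zero} {suc n} _ = refl
<⇒≡ᵇ-false {suc m} {suc n} (s≤s m<n) = <⇒≡ᵇ-false m<n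

pathCode-start : ∀ p → Head0 (pathCode p 0)
pathCode-start zero = tt
pathCode-start (suc r) = refl

pathCode-head : ∀ p {x} → x < p → Head0 (pathCode p x)
pathCode-head (suc r) x<p = <⇒≡ᵇ-false x<p

-- The code is a Fibonacci string: a leading 1 is followed by the code of 0, which starts with 0.
pathCode-fib : ∀ p x → Fib (pathCode p x)
pathCode-fib zero x = tt
pathCode-fib (suc r) x with x ≡ᵇ suc r in top
... | false = pathCode-fib r (r ∸ x)
... | true = Fib-true _ (pathCode-fib r (r ∸ x)) (subst (λ z → Head0 (pathCode r z)) (sym r∸x≡0) (pathCode-start r))
  where
  r∸x≡0 : r ∸ x ≡ 0
  r∸x≡0 = m≤n⇒m∸n≡0 (≤-trans (n≤1+n r) (≤-reflexive (sym (≡ᵇ⇒≡ x (suc r) (Equivalence.from BoolP.T-≡ top)))))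

pathCode-dist : ∀ p {x y} → x ≤ p → y ≤ p → hamming (pathCode p x) (pathCode p y) ≡ ∣ x - y ∣

pathCode-end-dist : ∀ r {y} → y ≤ r → hamming (pathCode (suc r) (suc r)) (pathCode (suc r) y) ≡ ∣ suc r - y ∣
pathCode-end-dist r {y} y≤r rewrite ≡ᵇ-refl r | <⇒≡ᵇ-false (s≤s y≤r) = begin
  suc (hamming (pathCode r (r ∸ suc r)) (pathCode r (r ∸ y)))   ≡⟨ cong (λ z → suc (hamming (pathCode r z) (pathCode r (r ∸ y)))) (m≤n⇒m∸n≡0 (n≤1+n r)) ⟩
  suc (hamming (pathCode r 0) (pathCode r (r ∸ y)))             ≡⟨ cong suc (pathCode-dist r z≤n (m∸n≤m r y)) ⟩
  suc (r ∸ y)                                                   ≡⟨ +-∸-assoc 1 y≤r ⟨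
  suc r ∸ y                                                     ≡⟨ m≤n⇒∣n-m∣≡n∸m (m≤n⇒m≤1+n y≤r) ⟨
  ∣ suc r - y ∣                                                 ∎
  where open ≡-Reasoning

pathCode-dist zero z≤n z≤n = refl
pathCode-dist (suc r) {x} {y} x≤p y≤p with m≤n⇒m<n∨m≡n x≤p | m≤n⇒m<n∨m≡n y≤p
... | inj₁ x<p | inj₁ y<p rewrite <⇒≡ᵇ-false x<p | <⇒≡ᵇ-false y<p =
  trans (pathCode-dist r (m∸n≤m r x) (m∸n≤m r y)) (reflect-dist r x y (≤-pred x<p) (≤-pred y<p))
... | inj₂ refl | inj₂ refl = trans (ham-self (pathCode (suc r) (suc r))) (sym (∣n-n∣≡0 (suc r)))
... | inj₂ refl | inj₁ y<p = pathCode-end-dist r (≤-pred y<p)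
... | inj₁ x<p | inj₂ refl = trans (ham-sym (pathCode (suc r) x) (pathCode (suc r) (suc r))) (trans (pathCode-end-dist r (≤-pred x<p)) (∣-∣-comm (suc r) x))

boxCode : ∀ p q → ℕ → ℕ → Vec Bool (p + q)
boxCode p q a b = reverse (pathCode p a) ++ pathCode q b

boxCode-dist : ∀ p q {a a′ b b′} → a ≤ p → a′ ≤ p → b ≤ q → b′ ≤ q →
  hamming (boxCode p q a b) (boxCode p q a′ b′) ≡ ∣ a - a′ ∣ + ∣ b - b′ ∣
boxCode-dist p q {a} {a′} a≤p a′≤p b≤q b′≤q = trans (ham-++ (reverse (pathCode p a)) (reverse (pathCode p a′)) _ _)
  (cong₂ _+_ (trans (ham-reverse (pathCode p a) _) (pathCode-dist p a≤p a′≤p)) (pathCode-dist q b≤q b′≤q))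

-- Only at the far corner (p , q) does the junction of a code read 11.
boxCode-fib : ∀ p q {a b} → a ≤ p → b ≤ q → a ≢ p ⊎ b ≢ q → Fib (boxCode p q a b)
boxCode-fib p q {a} {b} a≤p b≤q off-corner =
  Fib-++ (reverse (pathCode p a)) (pathCode q b) (Fib-reverse (pathCode p a) (pathCode-fib p a)) (pathCode-fib q b) (⊎-map a-end b-head off-corner)
  where
  a-end : a ≢ p → End0 (reverse (pathCode p a))
  a-end a≢p = End0-reverse _ (pathCode-head p (≤∧≢⇒< a≤p a≢p))
  b-head : b ≢ q → Head0 (pathCode q b)
  b-head b≢q = pathCode-head q (≤∧≢⇒< b≤q b≢q)

module _ {G : Graph} {p q} (C : Coordinates G p q) where
  open Coordinates C

  vertexCode : V G → Vec Bool (p + q)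
  vertexCode v = boxCode p q (α v) (β v)

  vertexCode-dist : ∀ u v → hamming (vertexCode u) (vertexCode v) ≡ rect α β u v
  vertexCode-dist u v = boxCode-dist p q (α≤p u) (α≤p v) (β≤q u) (β≤q v)

  cube-embedding : Embeds G (Cube (p + q))
  cube-embedding = vertexCode , isometry rect-metric (cube-metric (p + q)) vertexCode vertexCode-dist

  fib-embedding : ¬ Corner C p q → Embeds G (FibCube (p + q))
  fib-embedding empty = (λ v → vertexCode v , vertexCode-fib v) , isometry rect-metric (fib-metric (p + q)) _ vertexCode-dist
    where
    vertexCode-fib : ∀ v → Fib (vertexCode v)
    vertexCode-fib v with α v ≟ p
    ... | no αv≢p = boxCode-fib p q (α≤p v) (β≤q v) (inj₁ αv≢p)
    ... | yes αv≡p = boxCode-fib p q (α≤p v) (β≤q v) (inj₂ (λ βv≡q → empty (v , αv≡p , βv≡q)))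

-- fdim(G) ≤ p + q + 1 in general: the corner (p , q + 1) of a larger box is empty.
fib-embedding-relaxed : ∀ {G : Graph} {p q} → Coordinates G p q → Embeds G (FibCube (p + q + 1))
fib-embedding-relaxed {G} {p} {q} C = subst (Embeds G ∘ FibCube) (trans (+-suc p q) (+-comm 1 (p + q)))
  (fib-embedding (relax C) λ (v , _ , βv≡1+q) → 1+n≰n (subst (_≤ q) βv≡1+q (Coordinates.β≤q C v)))

reflectβ : ∀ {G p q} → Coordinates G p q → Coordinates G p q
reflectβ C = swap (reflect (swap C))

reflectβ-corner : ∀ {G p q} (C : Coordinates G p q) {i} → Corner (reflectβ C) i q → Corner C i 0
reflectβ-corner C (v , αv , βv) with reflect-corner (swap C) (v , βv , αv)
... | u , βu≡0 , αu≡i = u , αu≡i , βu≡0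

-- fdim(G) ≤ p + q if some corner of the box is empty: reflections move it to (p , q).
fib-embedding-corner : ∀ {G : Graph} {p q} (C : Coordinates G p q) →
  ¬ Corner C 0 0 ⊎ ¬ Corner C 0 q ⊎ ¬ Corner C p 0 ⊎ ¬ Corner C p q → Embeds G (FibCube (p + q))
fib-embedding-corner C (inj₁ empty) = fib-embedding (reflectβ (reflect C)) (empty ∘ reflect-corner C ∘ reflectβ-corner (reflect C))
fib-embedding-corner C (inj₂ (inj₁ empty)) = fib-embedding (reflect C) (empty ∘ reflect-corner C)
fib-embedding-corner C (inj₂ (inj₂ (inj₁ empty))) = fib-embedding (reflectβ C) (empty ∘ reflectβ-corner C)
fib-embedding-corner C (inj₂ (inj₂ (inj₂ empty))) = fib-embedding C empty

record Box (G : Graph) (p q : ℕ) : Set where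
  field
    coordinates : Coordinates G p q
    left right bottom top : V G
    at-left : Coordinates.α coordinates left ≡ 0
    at-right : Coordinates.α coordinates right ≡ p
    at-bottom : Coordinates.β coordinates bottom ≡ 0
    at-top : Coordinates.β coordinates top ≡ q

swap-box : ∀ {G p q} → Box G p q → Box G q p
swap-box B = record
  { coordinates = swap coordinates ; left = bottom ; right = top ; bottom = left ; top = right
  ; at-left = at-bottom ; at-right = at-top ; at-bottom = at-left ; at-top = at-right }
  where open Box B

argmin : ∀ {n} (f : Fin (suc n) → ℤ) → Σ (Fin (suc n)) λ i → ∀ j → f i ℤ.≤ f j
argmin {zero} f = Fin.zero , λ { Fin.zero → ℤP.≤-refl }
argmin {suc n} f with argmin (f ∘ Fin.suc)
... | i , min with f Fin.zero ℤ.≤? f (Fin.suc i)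
... | yes le = Fin.zero , λ { Fin.zero → ℤP.≤-refl ; (Fin.suc j) → ℤP.≤-trans le (min j) }
... | no ≰ = Fin.suc i , λ { Fin.zero → ℤP.<⇒≤ (ℤP.≰⇒> ≰) ; (Fin.suc j) → min j }

argmax : ∀ {n} (f : Fin (suc n) → ℤ) → Σ (Fin (suc n)) λ i → ∀ j → f j ℤ.≤ f i
argmax f = let i , min = argmin (ℤ.-_ ∘ f) in i , λ j → ℤP.neg-cancel-≤ (min j)

module Shift {n} (X : Fin (suc n) → ℤ) where
  lo hi : Fin (suc n)
  lo = proj₁ (argmin X)
  hi = proj₁ (argmax X)

  shifted : Fin (suc n) → ℕ
  shifted v = ℤ.∣ X v ℤ.- X lo ∣

  +shifted : ∀ v → ℤ.+ shifted v ≡ X v ℤ.- X lo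
  +shifted v = ℤP.0≤i⇒+∣i∣≡i (ℤP.i≤j⇒0≤j-i (proj₂ (argmin X) v))

  shifted-lo : shifted lo ≡ 0
  shifted-lo = cong ℤ.∣_∣ (ℤP.+-inverseʳ (X lo))

  shifted-≤ : ∀ v → shifted v ≤ shifted hi
  shifted-≤ v = ℤP.drop‿+≤+ (subst₂ ℤ._≤_ (sym (+shifted v)) (sym (+shifted hi))
    (ℤP.+-monoˡ-≤ (ℤ.- X lo) (proj₂ (argmax X) v)))

  shifted-dist : ∀ u v → ℤ.∣ X u ℤ.- X v ∣ ≡ ∣ shifted u - shifted v ∣
  shifted-dist u v = begin
    ℤ.∣ X u ℤ.- X v ∣                                ≡⟨ cong ℤ.∣_∣ (recentre (X u) (X v) (X lo)) ⟩
    ℤ.∣ (X u ℤ.- X lo) ℤ.- (X v ℤ.- X lo) ∣          ≡⟨ cong₂ (λ a b → ℤ.∣ a ℤ.- b ∣) (+shifted u) (+shifted v) ⟨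
    ℤ.∣ ℤ.+ shifted u ℤ.- ℤ.+ shifted v ∣            ≡⟨ ∣+m-+n∣ (shifted u) (shifted v) ⟩
    ∣ shifted u - shifted v ∣                        ∎
    where
    open ≡-Reasoning
    recentre : ∀ x y m → x ℤ.- y ≡ (x ℤ.- m) ℤ.- (y ℤ.- m)
    recentre = ℤSolver.solve-∀

l1-plane : ∀ (w w′ : Vec ℤ 2) → l1 w w′ ≡ ℤ.∣ head w ℤ.- head w′ ∣ + ℤ.∣ head (tail w) ℤ.- head (tail w′) ∣
l1-plane (x ∷ y ∷ []) (x′ ∷ y′ ∷ []) = cong (ℤ.∣ x ℤ.- x′ ∣ +_) (+-identityʳ _)

box-from-plane : ∀ {n} (G : FinGraph (suc n)) → Embeds (toGraph G) (Lattice 2) →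
  Σ ℕ λ p → Σ ℕ λ q → Box (toGraph G) p q
box-from-plane G (g , g-iso) = shifted hi , Y.shifted Y.hi , record
  { coordinates = record
    { α = shifted ; β = Y.shifted ; α≤p = shifted-≤ ; β≤q = Y.shifted-≤
    ; rect-metric = metric-cong plane-dist (pullback-metric (lattice-metric 2) g g-iso) }
  ; left = lo ; right = hi ; bottom = Y.lo ; top = Y.hi
  ; at-left = shifted-lo ; at-right = refl ; at-bottom = Y.shifted-lo ; at-top = refl }
  where
  open Shift (λ v → head (g v))
  module Y = Shift (λ v → head (tail (g v)))
  plane-dist : ∀ u v → l1 (g u) (g v) ≡ rect shifted Y.shifted u v
  plane-dist u v = trans (l1-plane (g u) (g v)) (cong₂ _+_ (shifted-dist u v) (Y.shifted-dist u v))

Θ-free-stillˡ : ∀ x y x′ y′ → y ≡ x → Θ-free ∣_-_∣ x y x′ y′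
Θ-free-stillˡ x _ x′ y′ refl = +-comm ∣ x - y′ ∣ ∣ x - x′ ∣

Θ-free-stillʳ : ∀ x y x′ y′ → y′ ≡ x′ → Θ-free ∣_-_∣ x y x′ y′
Θ-free-stillʳ x y x′ _ refl = refl

Θ-free-steps : ∀ {x y x′ y′} → y ≡ suc x → y′ ≡ suc x′ → x ≢ x′ → Θ-free ∣_-_∣ x y x′ y′
Θ-free-steps {x} {_} {x′} refl refl x≢x′ = trans (apart x x′ x≢x′) (cong (∣ x - x′ ∣ +_) (sym (∣-∣-comm x x′)))
  where
  apart : ∀ x x′ → x ≢ x′ → ∣ x - suc x′ ∣ + ∣ suc x - x′ ∣ ≡ ∣ x - x′ ∣ + ∣ x′ - x ∣
  apart zero zero ne = ⊥-elim (ne refl)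
  apart zero (suc x′) _ = cong suc (sym (+-suc x′ x′))
  apart (suc x) zero _ = trans (cong (_+ suc (suc x)) (∣-∣-identityʳ x)) (+-suc x (suc x))
  apart (suc x) (suc x′) ne = apart x x′ (ne ∘ cong suc)

Θ-free-rect : ∀ {A : Set} (α β : A → ℕ) {u v u′ v′} →
  Θ-free ∣_-_∣ (α u) (α v) (α u′) (α v′) → Θ-free ∣_-_∣ (β u) (β v) (β u′) (β v′) → Θ-free (rect α β) u v u′ v′
Θ-free-rect α β {u} {v} {u′} {v′} α-free β-free = begin
  (∣ α u - α v′ ∣ + ∣ β u - β v′ ∣) + (∣ α v - α u′ ∣ + ∣ β v - β u′ ∣)
    ≡⟨ interchange ∣ α u - α v′ ∣ _ _ _ ⟩
  (∣ α u - α v′ ∣ + ∣ α v - α u′ ∣) + (∣ β u - β v′ ∣ + ∣ β v - β u′ ∣)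
    ≡⟨ cong₂ _+_ α-free β-free ⟩
  (∣ α u - α u′ ∣ + ∣ α v - α v′ ∣) + (∣ β u - β u′ ∣ + ∣ β v - β v′ ∣)
    ≡⟨ interchange ∣ α u - α u′ ∣ _ _ _ ⟩
  (∣ α u - α u′ ∣ + ∣ β u - β u′ ∣) + (∣ α v - α v′ ∣ + ∣ β v - β v′ ∣) ∎
  where open ≡-Reasoning

∣n-1+n∣ : ∀ n → ∣ n - suc n ∣ ≡ 1
∣n-1+n∣ zero = refl
∣n-1+n∣ (suc n) = ∣n-1+n∣ n

horizontal-unit : ∀ {G p q} (C : Coordinates G p q) {i x y} → Horizontal C i x y → rect (Coordinates.α C) (Coordinates.β C) x y ≡ 1
horizontal-unit C {x = x} (_ , αy , βy) = cong₂ _+_ (trans (cong (∣ α x -_∣) αy) (∣n-1+n∣ (α x))) (trans (cong (∣ β x -_∣) βy) (∣n-n∣≡0 (β x)))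
  where open Coordinates C

horizontal-cut : ∀ {G p q} (B : Box G p q) i → i < p → Σ (V G) λ x → Σ (V G) λ y → Horizontal (Box.coordinates B) i x y
horizontal-cut B i i<p with crossing-edge (geodesic rect-metric left right) α (subst (_≤ i) (sym at-left) z≤n) (subst (i <_) (sym at-right) i<p)
  where open Box B ; open Coordinates coordinates
... | x , y , e , x≤i , i<y = x , y , climbing-edge (Box.coordinates B) e x≤i i<y

module _ {G : Graph} {p q} (B : Box G p q) where
  open Box B
  open Coordinates coordinates

  Cut : Fin p ⊎ Fin q → V G → V G → Set
  Cut (inj₁ i) = Horizontal coordinates (toℕ i)
  Cut (inj₂ j) = Horizontal (swap coordinates) (toℕ j)

  cut : ∀ l → Σ (V G) λ x → Σ (V G) λ y → Cut l x y
  cut (inj₁ i) = horizontal-cut B (toℕ i) (FinP.toℕ<n i)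
  cut (inj₂ j) = horizontal-cut (swap-box B) (toℕ j) (FinP.toℕ<n j)

  cut-unit : ∀ l {x y} → Cut l x y → rect α β x y ≡ 1
  cut-unit (inj₁ i) h = horizontal-unit coordinates h
  cut-unit (inj₂ j) {x} {y} h = trans (+-comm ∣ α x - α y ∣ _) (horizontal-unit (swap coordinates) h)

  -- Distinct cuts are Θ-free: on each axis the two edges are constant or climb at different levels.
  cuts-Θ-free : ∀ l l′ {x y x′ y′} → Cut l x y → Cut l′ x′ y′ → l ≢ l′ → Θ-free (rect α β) x y x′ y′
  cuts-Θ-free (inj₁ i) (inj₁ i′) {x} {y} {x′} {y′} (αx , αy , βy) (αx′ , αy′ , βy′) l≢l′ =
    Θ-free-rect α β (Θ-free-steps αy αy′ (λ eq → l≢l′ (cong inj₁ (FinP.toℕ-injective (trans (sym αx) (trans eq αx′))))))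
                    (Θ-free-stillˡ (β x) (β y) (β x′) (β y′) βy)
  cuts-Θ-free (inj₁ i) (inj₂ j) {x} {y} {x′} {y′} (_ , _ , βy) (_ , _ , αy′) _ =
    Θ-free-rect α β (Θ-free-stillʳ (α x) (α y) (α x′) (α y′) αy′) (Θ-free-stillˡ (β x) (β y) (β x′) (β y′) βy)
  cuts-Θ-free (inj₂ j) (inj₁ i) {x} {y} {x′} {y′} (_ , _ , αy) (_ , _ , βy′) _ =
    Θ-free-rect α β (Θ-free-stillˡ (α x) (α y) (α x′) (α y′) αy) (Θ-free-stillʳ (β x) (β y) (β x′) (β y′) βy′)
  cuts-Θ-free (inj₂ j) (inj₂ j′) {x} {y} {x′} {y′} (βx , βy , αy) (βx′ , βy′ , αy′) l≢l′ =
    Θ-free-rect α β (Θ-free-stillˡ (α x) (α y) (α x′) (α y′) αy)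
                    (Θ-free-steps βy βy′ (λ eq → l≢l′ (cong inj₂ (FinP.toℕ-injective (trans (sym βx) (trans eq βx′))))))

  -- idim(G) ≥ p + q: the p + q cut edges are pairwise Θ-free.
  cube-lower-bound : ∀ {m} → Embeds G (Cube m) → p + q ≤ m
  cube-lower-bound = Θ-free-bound rect-metric (λ c → proj₁ (edge c)) (λ c → proj₁ (proj₂ (edge c)))
    (λ c → cut-unit (Fin.splitAt p c) (proj₂ (proj₂ (edge c))))
    (λ c c′ c≢c′ → cuts-Θ-free _ _ (proj₂ (proj₂ (edge c))) (proj₂ (proj₂ (edge c′))) (c≢c′ ∘ splitAt-injective))
    where
    edge : ∀ c → Σ (V G) λ x → Σ (V G) λ y → Cut (Fin.splitAt p c) x y
    edge c = cut (Fin.splitAt p c)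
    splitAt-injective : ∀ {c c′} → Fin.splitAt p c ≡ Fin.splitAt p c′ → c ≡ c′
    splitAt-injective {c} {c′} eq = trans (sym (FinP.join-splitAt p q c)) (trans (cong (Fin.join p q) eq) (FinP.join-splitAt p q c′))

rect-triangle : ∀ {A : Set} (α β : A → ℕ) u v w → rect α β u w ≤ rect α β u v + rect α β v w
rect-triangle α β u v w = ≤-trans (+-mono-≤ (∣-∣-triangle (α u) (α v) (α w)) (∣-∣-triangle (β u) (β v) (β w)))
  (≤-reflexive (interchange ∣ α u - α v ∣ ∣ α v - α w ∣ ∣ β u - β v ∣ ∣ β v - β w ∣))

rect-unit-step : ∀ {A : Set} (α β : A → ℕ) {u w} v → rect α β u w ≡ 1 → rect α β u v ≤ suc (rect α β w v)
rect-unit-step α β {u} {w} v unit = subst (λ d → rect α β u v ≤ d + rect α β w v) unit (rect-triangle α β u w v)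

∣-∣≡1 : ∀ m n → ∣ m - n ∣ ≡ 1 → suc m ≡ n ⊎ suc n ≡ m
∣-∣≡1 zero (suc zero) _ = inj₁ refl
∣-∣≡1 (suc zero) zero _ = inj₂ refl
∣-∣≡1 (suc m) (suc n) eq = ⊎-map (cong suc) (cong suc) (∣-∣≡1 m n eq)

unit-sum : ∀ a b c d → ∣ a - b ∣ + ∣ c - d ∣ ≡ 1 → (a ≡ b × ∣ c - d ∣ ≡ 1) ⊎ (∣ a - b ∣ ≡ 1 × c ≡ d)
unit-sum a b c d eq with ∣ a - b ∣ in ab | ∣ c - d ∣ in cd
... | 0 | _ = inj₁ (∣m-n∣≡0⇒m≡n ab , eq)
... | 1 | 0 = inj₂ (refl , ∣m-n∣≡0⇒m≡n cd)

PathGraph : ℕ → Graph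
PathGraph a = record { V = Fin a ; E = _adj1_ }

adj1⇔ : ∀ {a} {i j : Fin a} → i adj1 j ⇔ (∣ toℕ i - toℕ j ∣ ≡ 1)
adj1⇔ {i = i} {j} = mk⇔ to (∣-∣≡1 (toℕ i) (toℕ j))
  where
  to : i adj1 j → ∣ toℕ i - toℕ j ∣ ≡ 1
  to (inj₁ up) = trans (cong (∣ toℕ i -_∣) (sym up)) (∣n-1+n∣ (toℕ i))
  to (inj₂ down) = trans (cong (∣_- toℕ j ∣) (sym down)) (trans (∣-∣-comm (suc (toℕ j)) (toℕ j)) (∣n-1+n∣ (toℕ j)))

path-undirected : ∀ {a} → Undirected (PathGraph a)
path-undirected (inj₁ up) = inj₂ up
path-undirected (inj₂ down) = inj₁ down

ascending-path : ∀ {a} (i : Fin a) k (i′ : Fin a) → toℕ i + k ≡ toℕ i′ → Walk (PathGraph a) i i′ k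
ascending-path i zero i′ eq = subst (λ x → Walk (PathGraph _) i x 0) (FinP.toℕ-injective (trans (sym (+-identityʳ _)) eq)) here
ascending-path i (suc k) i′ eq =
  step (inj₁ (sym (FinP.toℕ-fromℕ< next<a))) (ascending-path (fromℕ< next<a) k i′ (trans (cong (_+ k) (FinP.toℕ-fromℕ< next<a)) eq′))
  where
  eq′ : suc (toℕ i + k) ≡ toℕ i′
  eq′ = trans (sym (+-suc (toℕ i) k)) eq
  next<a : suc (toℕ i) < _
  next<a = ≤-<-trans (≤-trans (s≤s (m≤m+n (toℕ i) k)) (≤-reflexive eq′)) (FinP.toℕ<n i′)

path-walk : ∀ {a} (i i′ : Fin a) → Walk (PathGraph a) i i′ ∣ toℕ i - toℕ i′ ∣
path-walk i i′ with ≤-total (toℕ i) (toℕ i′)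
... | inj₁ i≤i′ = subst (Walk (PathGraph _) i i′) (sym (m≤n⇒∣m-n∣≡n∸m i≤i′)) (ascending-path i _ i′ (m+[n∸m]≡n i≤i′))
... | inj₂ i′≤i = subst (Walk (PathGraph _) i i′) (sym (m≤n⇒∣n-m∣≡n∸m i′≤i))
  (walk-reverse path-undirected (ascending-path i′ _ i (m+[n∸m]≡n i′≤i)))

δGrid : ∀ {a b} → Fin a × Fin b → Fin a × Fin b → ℕ
δGrid = rect (toℕ ∘ proj₁) (toℕ ∘ proj₂)

grid-edge⇔ : ∀ {a b} {u v : Fin a × Fin b} → E (GridGraph a b) u v ⇔ (δGrid u v ≡ 1)
grid-edge⇔ {u = i , j} {i′ , j′} = mk⇔ to from
  where
  to : E (GridGraph _ _) (i , j) (i′ , j′) → δGrid (i , j) (i′ , j′) ≡ 1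
  to (inj₁ (refl , adj)) = trans (cong (∣ toℕ i - toℕ i ∣ +_) (Equivalence.to adj1⇔ adj)) (cong (_+ 1) (∣n-n∣≡0 (toℕ i)))
  to (inj₂ (refl , adj)) = trans (cong (_+ ∣ toℕ j - toℕ j ∣) (Equivalence.to adj1⇔ adj)) (cong suc (∣n-n∣≡0 (toℕ j)))
  from : δGrid (i , j) (i′ , j′) ≡ 1 → E (GridGraph _ _) (i , j) (i′ , j′)
  from unit with unit-sum (toℕ i) (toℕ i′) (toℕ j) (toℕ j′) unit
  ... | inj₁ (same , adj) = inj₁ (FinP.toℕ-injective same , Equivalence.from adj1⇔ adj)
  ... | inj₂ (adj , same) = inj₂ (FinP.toℕ-injective same , Equivalence.from adj1⇔ adj)

grid-walk : ∀ {a b} (u v : Fin a × Fin b) → Walk (GridGraph a b) u v (δGrid u v)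
grid-walk (i , j) (i′ , j′) = walk-++
  (walk-map (PathGraph _) (GridGraph _ _) (_, j) (λ adj → inj₂ (refl , adj)) (path-walk i i′))
  (walk-map (PathGraph _) (GridGraph _ _) (i′ ,_) (λ adj → inj₁ (refl , adj)) (path-walk j j′))

grid-metric : ∀ a b → IsPathMetric (GridGraph a b) δGrid
grid-metric a b = path-metric δGrid (λ (i , j) → cong₂ _+_ (∣n-n∣≡0 (toℕ i)) (∣n-n∣≡0 (toℕ j)))
  (λ {u} {w} v e → rect-unit-step (toℕ ∘ proj₁) (toℕ ∘ proj₂) {u} {w} v (Equivalence.to (grid-edge⇔ {u = u} {w}) e)) grid-walk

grid-coordinates : ∀ {G : Graph} {a b} → Isomorphic G (GridGraph (suc a) (suc b)) → Coordinates G a b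
grid-coordinates iso@(φ , _) = record
  { α = toℕ ∘ proj₁ ∘ φ ; β = toℕ ∘ proj₂ ∘ φ
  ; α≤p = λ v → ≤-pred (FinP.toℕ<n (proj₁ (φ v))) ; β≤q = λ v → ≤-pred (FinP.toℕ<n (proj₂ (φ v)))
  ; rect-metric = iso-metric (grid-metric _ _) iso }

grid-corner : ∀ {G : Graph} {a b} (iso : Isomorphic G (GridGraph (suc a) (suc b))) {i j} → i ≤ a → j ≤ b →
  Corner (grid-coordinates iso) i j
grid-corner (φ , _ , φ-surj , _) i≤a j≤b with φ-surj (fromℕ< (s≤s i≤a) , fromℕ< (s≤s j≤b))
... | v , φv = v , trans (cong (toℕ ∘ proj₁) φv) (FinP.toℕ-fromℕ< (s≤s i≤a)) , trans (cong (toℕ ∘ proj₂) φv) (FinP.toℕ-fromℕ< (s≤s j≤b))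

module _ {G : Graph} {p q} (C : Coordinates G p q) where
  open Coordinates C

  -- Conversely, if the four corners of the box are occupied, so is every
  -- lattice point: fill the left and right sides, then the row between them.
  fill-box : Corner C 0 0 → Corner C 0 q → Corner C p 0 → Corner C p q → ∀ {i j} → i ≤ p → j ≤ q → Corner C i j
  fill-box (v₀₀ , α₀₀ , β₀₀) (v₀q , α₀q , β₀q) (vp₀ , αp₀ , βp₀) (vpq , αpq , βpq) {i} {j} i≤p j≤q
    with fill-segment C (trans α₀₀ (sym α₀q)) (subst (_≤ j) (sym β₀₀) z≤n) (subst (j ≤_) (sym β₀q) j≤q)
       | fill-segment C (trans αp₀ (sym αpq)) (subst (_≤ j) (sym βp₀) z≤n) (subst (j ≤_) (sym βpq) j≤q)
  ... | l , αl , βl | r , αr , βr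
    with fill-segment (swap C) (trans βl (sym βr)) (subst (_≤ i) (sym (trans αl α₀₀)) z≤n) (subst (i ≤_) (sym (trans αr αp₀)) i≤p)
  ... | x , βx , αx = x , αx , trans βx βl

  -- A loopless graph with all four corners of its box occupied is the grid
  -- P_{p+1} □ P_{q+1}: the coordinates themselves are the isomorphism.
  grid-from-corners : (∀ {u} → ¬ E G u u) → Corner C 0 0 → Corner C 0 q → Corner C p 0 → Corner C p q →
    Isomorphic G (GridGraph (suc p) (suc q))
  grid-from-corners loopless c₀₀ c₀q cp₀ cpq = φ , φ-injective , φ-surjective , λ u v →
    mk⇔ (Equivalence.from (grid-edge⇔ {u = φ u} {φ v}) ∘ subst (_≡ 1) (φ-rect u v) ∘ Equivalence.to (edge⇔unit rect-metric loopless))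
        (Equivalence.from (edge⇔unit rect-metric loopless) ∘ subst (_≡ 1) (sym (φ-rect u v)) ∘ Equivalence.to (grid-edge⇔ {u = φ u} {φ v}))
    where
    φ : V G → Fin (suc p) × Fin (suc q)
    φ v = fromℕ< (s≤s (α≤p v)) , fromℕ< (s≤s (β≤q v))
    φ-rect : ∀ u v → rect α β u v ≡ δGrid (φ u) (φ v)
    φ-rect u v = sym (cong₂ _+_ (cong₂ ∣_-_∣ (FinP.toℕ-fromℕ< (s≤s (α≤p u))) (FinP.toℕ-fromℕ< (s≤s (α≤p v))))
                                (cong₂ ∣_-_∣ (FinP.toℕ-fromℕ< (s≤s (β≤q u))) (FinP.toℕ-fromℕ< (s≤s (β≤q v)))))
    φ-injective : ∀ {u v} → φ u ≡ φ v → u ≡ v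
    φ-injective {u} {v} φu≡φv = δ-zero rect-metric (trans (φ-rect u v)
      (trans (cong (δGrid (φ u)) (sym φu≡φv)) (δ-diag (grid-metric _ _) (φ u))))
    φ-surjective : ∀ y → Σ (V G) λ v → φ v ≡ y
    φ-surjective (i , j) with fill-box c₀₀ c₀q cp₀ cpq (≤-pred (FinP.toℕ<n i)) (≤-pred (FinP.toℕ<n j))
    ... | v , αv , βv = v , cong₂ _,_ (FinP.toℕ-injective (trans (FinP.toℕ-fromℕ< _) αv))
                                      (FinP.toℕ-injective (trans (FinP.toℕ-fromℕ< _) βv))

-- Grids do not fit into Fibonacci cubes of dimension idim.

~_ : ∀ {m} → Vec Bool m → Vec Bool m
~_ = Vec.map not

~-involutive : ∀ {m} (x : Vec Bool m) → ~ ~ x ≡ x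
~-involutive [] = refl
~-involutive (a ∷ x) = cong₂ _∷_ (BoolP.not-involutive a) (~-involutive x)

ham-≤ : ∀ {m} (x y : Vec Bool m) → hamming x y ≤ m
ham-≤ [] [] = z≤n
ham-≤ (a ∷ x) (b ∷ y) with a | b
... | false | false = m≤n⇒m≤1+n (ham-≤ x y)
... | true  | true  = m≤n⇒m≤1+n (ham-≤ x y)
... | false | true  = s≤s (ham-≤ x y)
... | true  | false = s≤s (ham-≤ x y)

ham-antipodal : ∀ {m} (x y : Vec Bool m) → hamming x y ≡ m → y ≡ ~ x
ham-antipodal [] [] _ = refl
ham-antipodal (a ∷ x) (b ∷ y) eq with a | b
... | false | false = ⊥-elim (1+n≰n (subst (_≤ _) eq (ham-≤ x y)))
... | true  | true  = ⊥-elim (1+n≰n (subst (_≤ _) eq (ham-≤ x y)))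
... | false | true  = cong (true ∷_) (ham-antipodal x y (suc-injective eq))
... | true  | false = cong (false ∷_) (ham-antipodal x y (suc-injective eq))

Alternating : ∀ {m} → Vec Bool m → Set
Alternating [] = ⊤
Alternating (a ∷ []) = ⊤
Alternating (a ∷ b ∷ xs) = b ≡ not a × Alternating (b ∷ xs)

Fib-alternating : ∀ {m} (x : Vec Bool m) → Fib x → Fib (~ x) → Alternating x
Fib-alternating [] _ _ = tt
Fib-alternating (a ∷ []) _ _ = tt
Fib-alternating (true ∷ false ∷ xs) f f~ = refl , Fib-alternating (false ∷ xs) f f~
Fib-alternating (false ∷ true ∷ xs) f f~ = refl , Fib-alternating (true ∷ xs) f f~

alternating-cases : ∀ {m} (x y : Vec Bool m) → Alternating x → Alternating y → x ≡ y ⊎ y ≡ ~ x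
alternating-cases [] [] _ _ = inj₁ refl
alternating-cases (a ∷ []) (b ∷ []) _ _ with a | b
... | false | false = inj₁ refl
... | true  | true  = inj₁ refl
... | false | true  = inj₂ refl
... | true  | false = inj₂ refl
alternating-cases (a ∷ b ∷ xs) (c ∷ d ∷ ys) (b≡ , alt-x) (d≡ , alt-y) with alternating-cases (b ∷ xs) (d ∷ ys) alt-x alt-y
... | inj₁ same = inj₁ (cong₂ _∷_ (BoolP.not-injective (trans (sym b≡) (trans (cong head same) d≡))) same)
... | inj₂ compl = inj₂ (cong₂ _∷_ (BoolP.not-injective (trans (sym d≡) (trans (cong head compl) (cong not b≡)))) compl)

complementable-cases : ∀ {m} {x y : Vec Bool m} → Fib x → Fib (~ x) → Fib y → Fib (~ y) → x ≡ y ⊎ x ≡ ~ y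
complementable-cases {x = x} {y} fx f~x fy f~y with alternating-cases x y (Fib-alternating x fx f~x) (Fib-alternating y fy f~y)
... | inj₁ x≡y = inj₁ x≡y
... | inj₂ y≡~x = inj₂ (trans (sym (~-involutive x)) (cong ~_ (sym y≡~x)))

-- A graph with coordinates filling a box of size a × b, a, b ≥ 1, does not
-- embed into Γ_m for m ≤ a + b: both diagonals of the box would join
-- complementary strings, forcing two distinct corners to share a code.
grid-obstruction : ∀ {G : Graph} {a b m} (C : Coordinates G a b) → 1 ≤ a → 1 ≤ b →
  Corner C 0 0 → Corner C a b → Corner C a 0 → Corner C 0 b → m ≤ a + b → ¬ Embeds G (FibCube m)
grid-obstruction {G} {a} {b} {m} C 1≤a 1≤b (o , αo , βo) (d , αd , βd) (r , αr , βr) (t , αt , βt) m≤a+b (f , f-iso) =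
  [ distinct o r side-a , (λ o~r → distinct o t side-b (trans o~r (sym (antipodal r t anti-diagonal)))) ]′
  (complementable-cases (fib o) (subst Fib (antipodal o d diagonal) (fib d)) (fib r) (subst Fib (antipodal r t anti-diagonal) (fib t)))
  where
  open Coordinates C
  code : V G → Vec Bool m
  code v = proj₁ (f v)
  fib : ∀ v → Fib (code v)
  fib v = proj₂ (f v)
  dist : ∀ u v → hamming (code u) (code v) ≡ rect α β u v
  dist = isometry-preserves rect-metric (fib-metric m) f f-iso
  antipodal : ∀ u v → rect α β u v ≡ a + b → code v ≡ ~ code u
  antipodal u v far = ham-antipodal (code u) (code v) (≤-antisym (ham-≤ (code u) (code v)) (subst (m ≤_) (sym (trans (dist u v) far)) m≤a+b))
  distinct : ∀ u v → 1 ≤ rect α β u v → code u ≢ code v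
  distinct u v apart same with subst (1 ≤_) (trans (sym (dist u v)) (trans (cong (hamming (code u)) (sym same)) (ham-self (code u)))) apart
  ... | ()
  diagonal : rect α β o d ≡ a + b
  diagonal = cong₂ _+_ (cong₂ ∣_-_∣ αo αd) (cong₂ ∣_-_∣ βo βd)
  anti-diagonal : rect α β r t ≡ a + b
  anti-diagonal = cong₂ _+_ (trans (cong₂ ∣_-_∣ αr αt) (∣-∣-identityʳ a)) (cong₂ ∣_-_∣ βr βt)
  side-a : 1 ≤ rect α β o r
  side-a = subst (1 ≤_) (sym (trans (cong₂ _+_ (cong₂ ∣_-_∣ αo αr) (cong₂ ∣_-_∣ βo βr)) (+-identityʳ a))) 1≤a
  side-b : 1 ≤ rect α β o t
  side-b = subst (1 ≤_) (sym (cong₂ _+_ (cong₂ ∣_-_∣ αo αt) (cong₂ ∣_-_∣ βo βt))) 1≤b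

-- The empty graph embeds everywhere; so ldim(G) = 2 forces G to be nonempty.
empty-embedding : ∀ (G : FinGraph 0) H → Embeds (toGraph G) H
empty-embedding G H = (λ ()) , (λ { {()} }) , λ ()

positive-width : ∀ {G : Graph} {a b} → Coordinates G a b → ¬ Embeds G (Lattice 1) → 1 ≤ a
positive-width {a = zero} C not-on-line = ⊥-elim (not-on-line (line-embedding C))
positive-width {a = suc a} C _ = s≤s z≤n

grid-not-in-Γ : ∀ {G : Graph} {p q} → Box G p q → ¬ Embeds G (Lattice 1) → IsProductOfTwoPaths G → ¬ Embeds G (FibCube (p + q))
grid-not-in-Γ B not-on-line (suc a , suc b , _ , _ , iso) = grid-obstruction C
  (positive-width C not-on-line) (positive-width (swap C) not-on-line)
  (grid-corner iso z≤n z≤n) (grid-corner iso ≤-refl ≤-refl) (grid-corner iso ≤-refl z≤n) (grid-corner iso z≤n ≤-refl)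
  (cube-lower-bound B (cube-embedding C))
  where
  C = grid-coordinates iso

grid-or-empty-corner : ∀ {n} (G : FinGraph n) {p q} (C : Coordinates (toGraph G) p q) →
  IsProductOfTwoPaths (toGraph G) ⊎ (¬ Corner C 0 0 ⊎ ¬ Corner C 0 q ⊎ ¬ Corner C p 0 ⊎ ¬ Corner C p q)
grid-or-empty-corner G {p} {q} C with corner? 0 0 | corner? 0 q | corner? p 0 | corner? p q
  where
  open Coordinates C
  corner? : ∀ i j → Dec (Corner C i j)
  corner? i j = FinP.any? (λ v → (α v ≟ i) ×-dec (β v ≟ j))
... | yes c₀₀ | yes c₀q | yes cp₀ | yes cpq = inj₁ (suc p , suc q , s≤s z≤n , s≤s z≤n , grid-from-corners C (Adj-irrefl G) c₀₀ c₀q cp₀ cpq)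
... | no empty | _ | _ | _ = inj₂ (inj₁ empty)
... | yes _ | no empty | _ | _ = inj₂ (inj₂ (inj₁ empty))
... | yes _ | yes _ | no empty | _ = inj₂ (inj₂ (inj₂ (inj₁ empty)))
... | yes _ | yes _ | yes _ | no empty = inj₂ (inj₂ (inj₂ (inj₂ empty)))

-- Here k = p + q, where p × q is the box of an embedding of G into ℤ².
proposition3p9 : ∀ {n} (G : FinGraph n) → IsLdim (toGraph G) 2 →
    Σ ℕ λ k → IsIdim (toGraph G) k ×
    (IsProductOfTwoPaths (toGraph G) → IsFdim (toGraph G) (k + 1)) ×
    (¬ IsProductOfTwoPaths (toGraph G) → IsFdim (toGraph G) k)
proposition3p9 {zero} G (_ , not-lower) = ⊥-elim (not-lower 0 (s≤s z≤n) (empty-embedding G _))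
proposition3p9 {suc n} G (in-plane , not-lower) with box-from-plane G in-plane
... | p , q , B = p + q , (cube-embedding C , idim-lower) , grid-case , non-grid-case
  where
  C = Box.coordinates B
  idim-lower : ∀ m → m < p + q → ¬ Embeds (toGraph G) (Cube m)
  idim-lower m m<k = <⇒≱ m<k ∘ cube-lower-bound B
  fdim-lower : ∀ m → m < p + q → ¬ Embeds (toGraph G) (FibCube m)
  fdim-lower m m<k = idim-lower m m<k ∘ fib→cube
  grid-case : IsProductOfTwoPaths (toGraph G) → IsFdim (toGraph G) (p + q + 1)
  grid-case grid = fib-embedding-relaxed C ,
    λ m m<k+1 → [ fdim-lower m , (λ { refl → grid-not-in-Γ B (not-lower 1 (s≤s (s≤s z≤n))) grid }) ]′
                (m<1+n⇒m<n∨m≡n (subst (m <_) (+-comm (p + q) 1) m<k+1))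
  non-grid-case : ¬ IsProductOfTwoPaths (toGraph G) → IsFdim (toGraph G) (p + q)
  non-grid-case not-grid = [ ⊥-elim ∘ not-grid , fib-embedding-corner C ]′ (grid-or-empty-corner G C) , fdim-lower
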